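{- Let $m(a,b,c)=F(a)^2+F(b)^2+F(c)^2-3F(a)F(b)F(c)$. Suppose $a,b,c,a',b'$ are integers with $2\le a\le b\le c$, $c\ge 5$, $2\le a\le a'\le c$ and $b\le b'\le c$. Then $m(a,b,c)\ge m(a',b',c)$, with equality if and only if $a=a'$ and $b=b'$. In particular, if $2\le a\le b\le c$, $c\ge 5$, and $(F(a),F(b),F(c))$ is a minimal Markoff $m$-triple with $m>0$, then $$m(2,2,c)\ge m(a,b,c)\ge m(a,c-a-1,c).$$
   Context: $F(n)$ denotes the $n$-th Fibonacci number, $F(0)=0$, $F(1)=1$, $F(n+1)=F(n)+F(n-1)$. A Markoff $m$-triple is a triple $(x,y,z)$ of positive integers with $x\le y\le z$ satisfying $x^2+y^2+z^2=3xyz+m$; it is minimal if $z\ge 3xy$. -}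

module Defs where

open import Data.Nat as ℕ using (ℕ; zero; suc)
open import Data.Integer as ℤ using (ℤ; +_)
open import Data.Product using (_×_)
open import Relation.Binary.PropositionalEquality using (_≡_)

F : ℕ → ℕ
F zero = zero
F (suc zero) = suc zero
F (suc (suc n)) = F (suc n) ℕ.+ F n

mval : ℕ → ℕ → ℕ → ℤ
mval a b c =
  (+ F a) ℤ.* (+ F a) ℤ.+ (+ F b) ℤ.* (+ F b) ℤ.+ (+ F c) ℤ.* (+ F c)
  ℤ.- (+ 3) ℤ.* (+ F a) ℤ.* (+ F b) ℤ.* (+ F c)

MarkoffTriple : ℤ → ℕ → ℕ → ℕ → Set
MarkoffTriple m x y z =
  (1 ℕ.≤ x) × (x ℕ.≤ y) × (y ℕ.≤ z) ×
  ((+ x) ℤ.* (+ x) ℤ.+ (+ y) ℤ.* (+ y) ℤ.+ (+ z) ℤ.* (+ z)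
     ≡ (+ 3) ℤ.* (+ x) ℤ.* (+ y) ℤ.* (+ z) ℤ.+ m)

MinimalMarkoffTriple : ℤ → ℕ → ℕ → ℕ → Set
MinimalMarkoffTriple m x y z = MarkoffTriple m x y z × (3 ℕ.* x ℕ.* y ℕ.≤ z)

{-# OPTIONS --safe #-}

-- For the Markoff form m(x,y,z) = x² + y² + z² − 3xyz one has
--   m(x,y,z) = m(x′,y,z) + (x′ − x)(3yz − x − x′),
-- and the second factor is positive when x ≤ x′ ≤ z and y ≥ 1; so m strictly decreases
-- when its first (by symmetry, its second) argument grows but stays ≤ z. Since F is
-- strictly increasing from index 2 on, this gives the comparison of m(a,b,c) with
-- m(a′,b′,c). For a minimal triple, 3F(a)F(b) ≤ F(c) forces a + b < c: otherwise
-- F(c) ≤ F(a+b) = F(a)F(b+1) + F(a−1)F(b) ≤ F(a)F(b+2) < 3F(a)F(b), using b ≥ 3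
-- (b ≤ 2 would give c ≤ 4). Hence b ≤ c − a − 1, and the comparison applies to
-- (2,2) ≤ (a,b) and to (a,b) ≤ (a, c−a−1).

module Submission where

open import Defs
open import Data.Nat using (ℕ; zero; suc; _+_; _*_; _∸_; _≤_; _<_; _≤′_; ≤′-refl; ≤′-step; z≤n; s≤s; _≤?_; >-nonZero)
open import Data.Nat.Properties
open import Data.Nat.Tactic.RingSolver as ℕ-Solver using ()
open import Data.Integer as ℤ using (ℤ; +_; 0ℤ; +<+)
import Data.Integer.Properties as ℤ
open import Data.Integer.Tactic.RingSolver as ℤ-Solver using ()
open import Data.Product using (_×_; _,_)
open import Data.Sum using (inj₁; inj₂)
open import Data.Empty using (⊥-elim)
open import Function.Base using (_∘_)
open import Function.Bundles using (_⇔_; mk⇔)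
open import Relation.Binary.PropositionalEquality
open import Relation.Binary using (tri<; tri≈; tri>)
open import Relation.Nullary using (¬_; yes; no)

markoff : ℤ → ℤ → ℤ → ℤ
markoff x y z = x ℤ.* x ℤ.+ y ℤ.* y ℤ.+ z ℤ.* z ℤ.- + 3 ℤ.* x ℤ.* y ℤ.* z

markoff-comm : ∀ x y z → markoff x y z ≡ markoff y x z
markoff-comm = polynomial-identity
  where
  polynomial-identity : ∀ x y z →
    x ℤ.* x ℤ.+ y ℤ.* y ℤ.+ z ℤ.* z ℤ.- + 3 ℤ.* x ℤ.* y ℤ.* z ≡
    y ℤ.* y ℤ.+ x ℤ.* x ℤ.+ z ℤ.* z ℤ.- + 3 ℤ.* y ℤ.* x ℤ.* z
  polynomial-identity = ℤ-Solver.solve-∀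

markoff-shift : ∀ x x′ y z →
  markoff x y z ≡ markoff x′ y z ℤ.+ (x′ ℤ.- x) ℤ.* (+ 3 ℤ.* y ℤ.* z ℤ.- (x ℤ.+ x′))
markoff-shift = polynomial-identity
  where
  polynomial-identity : ∀ x x′ y z →
    x ℤ.* x ℤ.+ y ℤ.* y ℤ.+ z ℤ.* z ℤ.- + 3 ℤ.* x ℤ.* y ℤ.* z ≡
    x′ ℤ.* x′ ℤ.+ y ℤ.* y ℤ.+ z ℤ.* z ℤ.- + 3 ℤ.* x′ ℤ.* y ℤ.* z
      ℤ.+ (x′ ℤ.- x) ℤ.* (+ 3 ℤ.* y ℤ.* z ℤ.- (x ℤ.+ x′))
  polynomial-identity = ℤ-Solver.solve-∀

i<j⇒0<j-i : ∀ {i j} → i ℤ.< j → 0ℤ ℤ.< j ℤ.- i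
i<j⇒0<j-i {i} {j} i<j = subst (ℤ._< j ℤ.- i) (ℤ.+-inverseʳ i) (ℤ.+-monoˡ-< (ℤ.- i) i<j)

0<i⇒0<j⇒0<i*j : ∀ {i j} → 0ℤ ℤ.< i → 0ℤ ℤ.< j → 0ℤ ℤ.< i ℤ.* j
0<i⇒0<j⇒0<i*j {i} {j} 0<i 0<j =
  subst (ℤ._< i ℤ.* j) (ℤ.*-zeroʳ i) (ℤ.*-monoˡ-<-pos i {{ℤ.positive 0<i}} 0<j)

markoff-<ˡ : ∀ {x x′ y z} → x ℤ.< x′ → x ℤ.+ x′ ℤ.< + 3 ℤ.* y ℤ.* z →
  markoff x′ y z ℤ.< markoff x y z
markoff-<ˡ {x} {x′} {y} {z} x<x′ x+x′<3yz = begin-strict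
  markoff x′ y z                ≡⟨ ℤ.+-identityʳ _ ⟨
  markoff x′ y z ℤ.+ 0ℤ         <⟨ ℤ.+-monoʳ-< (markoff x′ y z) gap-positive ⟩
  markoff x′ y z ℤ.+ (x′ ℤ.- x) ℤ.* (+ 3 ℤ.* y ℤ.* z ℤ.- (x ℤ.+ x′)) ≡⟨ markoff-shift x x′ y z ⟨
  markoff x y z                 ∎
  where
  open ℤ.≤-Reasoning
  gap-positive : 0ℤ ℤ.< (x′ ℤ.- x) ℤ.* (+ 3 ℤ.* y ℤ.* z ℤ.- (x ℤ.+ x′))
  gap-positive = 0<i⇒0<j⇒0<i*j (i<j⇒0<j-i x<x′) (i<j⇒0<j-i x+x′<3yz)

-- mval a b c is definitionally markoff⁺ (F a) (F b) (F c).
markoff⁺ : ℕ → ℕ → ℕ → ℤ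
markoff⁺ x y z = markoff (+ x) (+ y) (+ z)

x+x′<3yz : ∀ {x x′ y z} → x < x′ → x′ ≤ z → 1 ≤ y → x + x′ < 3 * y * z
x+x′<3yz {x} {x′} {y} {z} x<x′ x′≤z 1≤y = begin-strict
  x + x′     <⟨ +-mono-<-≤ (<-≤-trans x<x′ x′≤z) x′≤z ⟩
  z + z      ≤⟨ +-monoʳ-≤ z (m≤m+n z (z + 0)) ⟩
  3 * z      ≤⟨ *-monoˡ-≤ z (*-monoʳ-≤ 3 1≤y) ⟩
  3 * y * z  ∎
  where open ≤-Reasoning

markoff⁺-<ˡ : ∀ {x x′ y z} → x < x′ → x′ ≤ z → 1 ≤ y → markoff⁺ x′ y z ℤ.< markoff⁺ x y z
markoff⁺-<ˡ {x} {x′} {y} {z} x<x′ x′≤z 1≤y =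
  markoff-<ˡ (+<+ x<x′) (subst (+ (x + x′) ℤ.<_) +3yz≡3*y*z (+<+ (x+x′<3yz x<x′ x′≤z 1≤y)))
  where
  +3yz≡3*y*z : + (3 * y * z) ≡ + 3 ℤ.* + y ℤ.* + z
  +3yz≡3*y*z = trans (ℤ.pos-* (3 * y) z) (cong (ℤ._* + z) (ℤ.pos-* 3 y))

markoff⁺-≤ˡ : ∀ {x x′ y z} → x ≤ x′ → x′ ≤ z → 1 ≤ y → markoff⁺ x′ y z ℤ.≤ markoff⁺ x y z
markoff⁺-≤ˡ x≤x′ x′≤z 1≤y with m≤n⇒m<n∨m≡n x≤x′
... | inj₁ x<x′ = ℤ.<⇒≤ (markoff⁺-<ˡ x<x′ x′≤z 1≤y)
... | inj₂ refl = ℤ.≤-refl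

markoff⁺-<ʳ : ∀ {x y y′ z} → y < y′ → y′ ≤ z → 1 ≤ x → markoff⁺ x y′ z ℤ.< markoff⁺ x y z
markoff⁺-<ʳ {x} {y} {y′} {z} y<y′ y′≤z 1≤x =
  subst₂ ℤ._<_ (markoff-comm (+ y′) (+ x) (+ z)) (markoff-comm (+ y) (+ x) (+ z))
    (markoff⁺-<ˡ y<y′ y′≤z 1≤x)

markoff⁺-≤ʳ : ∀ {x y y′ z} → y ≤ y′ → y′ ≤ z → 1 ≤ x → markoff⁺ x y′ z ℤ.≤ markoff⁺ x y z
markoff⁺-≤ʳ {x} {y} {y′} {z} y≤y′ y′≤z 1≤x =
  subst₂ ℤ._≤_ (markoff-comm (+ y′) (+ x) (+ z)) (markoff-comm (+ y) (+ x) (+ z))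
    (markoff⁺-≤ˡ y≤y′ y′≤z 1≤x)

module _ {x x′ y y′ z : ℕ} (1≤x : 1 ≤ x) (1≤y : 1 ≤ y)
         (x≤x′ : x ≤ x′) (x′≤z : x′ ≤ z) (y≤y′ : y ≤ y′) (y′≤z : y′ ≤ z) where

  private
    1≤x′ : 1 ≤ x′
    1≤x′ = ≤-trans 1≤x x≤x′

  markoff⁺-antitone : markoff⁺ x′ y′ z ℤ.≤ markoff⁺ x y z
  markoff⁺-antitone = ℤ.≤-trans (markoff⁺-≤ʳ y≤y′ y′≤z 1≤x′) (markoff⁺-≤ˡ x≤x′ x′≤z 1≤y)

  markoff⁺-≡⇒≡ : markoff⁺ x y z ≡ markoff⁺ x′ y′ z → x ≡ x′ × y ≡ y′
  markoff⁺-≡⇒≡ eq = ≤∧≮⇒≡ x≤x′ x≮x′ , ≤∧≮⇒≡ y≤y′ y≮y′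
    where
    x≮x′ : ¬ x < x′
    x≮x′ x<x′ = ℤ.<⇒≢ (ℤ.≤-<-trans (markoff⁺-≤ʳ y≤y′ y′≤z 1≤x′) (markoff⁺-<ˡ x<x′ x′≤z 1≤y)) (sym eq)
    y≮y′ : ¬ y < y′
    y≮y′ y<y′ = ℤ.<⇒≢ (ℤ.<-≤-trans (markoff⁺-<ʳ y<y′ y′≤z 1≤x′) (markoff⁺-≤ˡ x≤x′ x′≤z 1≤y)) (sym eq)

F[n]≤F[1+n] : ∀ n → F n ≤ F (suc n)
F[n]≤F[1+n] zero          = z≤n
F[n]≤F[1+n] (suc zero)    = ≤-refl
F[n]≤F[1+n] (suc (suc n)) = m≤m+n (F (suc (suc n))) (F (suc n))

F-positive : ∀ {n} → 1 ≤ n → 1 ≤ F n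
F-positive {suc zero}    _ = ≤-refl
F-positive {suc (suc n)} _ = ≤-trans (F-positive {suc n} (s≤s z≤n)) (m≤m+n (F (suc n)) (F n))

F-mono-≤ : ∀ {m n} → m ≤ n → F m ≤ F n
F-mono-≤ m≤n = mono (≤⇒≤′ m≤n)
  where
  mono : ∀ {m n} → m ≤′ n → F m ≤ F n
  mono ≤′-refl                = ≤-refl
  mono (≤′-step {n = n} m≤′n) = ≤-trans (mono m≤′n) (F[n]≤F[1+n] n)

F[2+n]<F[3+n] : ∀ n → F (2 + n) < F (3 + n)
F[2+n]<F[3+n] n = m<m+n (F (2 + n)) (F-positive {suc n} (s≤s z≤n))

F-mono-< : ∀ {m n} → 2 ≤ m → m < n → F m < F n
F-mono-< {suc (suc k)} (s≤s (s≤s z≤n)) m<n = <-≤-trans (F[2+n]<F[3+n] k) (F-mono-≤ m<n)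

F-injective : ∀ {m n} → 2 ≤ m → 2 ≤ n → F m ≡ F n → m ≡ n
F-injective {m} {n} 2≤m 2≤n Fm≡Fn with <-cmp m n
... | tri< m<n _ _ = ⊥-elim (<⇒≢ (F-mono-< 2≤m m<n) Fm≡Fn)
... | tri≈ _ m≡n _ = m≡n
... | tri> _ _ n<m = ⊥-elim (<⇒≢ (F-mono-< 2≤n n<m) (sym Fm≡Fn))

F-+ : ∀ m n → F (suc (m + n)) ≡ F (suc m) * F (suc n) + F m * F n
F-+ zero    n = sym (trans (+-identityʳ _) (+-identityʳ _))
F-+ (suc m) n = begin
  F (suc (suc m + n))                             ≡⟨ cong (F ∘ suc) (+-suc m n) ⟨
  F (suc (m + suc n))                             ≡⟨ F-+ m (suc n) ⟩
  F (suc m) * F (suc (suc n)) + F m * F (suc n)   ≡⟨ regroup (F (suc m)) (F m) (F (suc n)) (F n) ⟩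
  F (suc (suc m)) * F (suc n) + F (suc m) * F n   ∎
  where
  open ≡-Reasoning
  regroup : ∀ a b c d → a * (c + d) + b * c ≡ (a + b) * c + a * d
  regroup = ℕ-Solver.solve-∀

F[2+n]<3*F[n] : ∀ {n} → 3 ≤ n → F (2 + n) < 3 * F n
F[2+n]<3*F[n] {suc (suc (suc k))} (s≤s (s≤s (s≤s z≤n))) = begin-strict
  F (3 + k) + F (2 + k) + F (3 + k)  <⟨ +-monoˡ-< (F (3 + k)) (+-monoʳ-< (F (3 + k)) (F[2+n]<F[3+n] k)) ⟩
  F (3 + k) + F (3 + k) + F (3 + k)  ≡⟨ thrice (F (3 + k)) ⟩
  3 * F (3 + k)                      ∎
  where
  open ≤-Reasoning
  thrice : ∀ u → u + u + u ≡ 3 * u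
  thrice = ℕ-Solver.solve-∀

F[m+n]<3*F[m]*F[n] : ∀ {m n} → 1 ≤ m → 3 ≤ n → F (m + n) < 3 * F m * F n
F[m+n]<3*F[m]*F[n] {suc m} {n} _ 3≤n = begin-strict
  F (suc m + n)                                ≡⟨ F-+ m n ⟩
  F (suc m) * F (suc n) + F m * F n            ≤⟨ +-monoʳ-≤ (F (suc m) * F (suc n)) (*-monoˡ-≤ (F n) (F[n]≤F[1+n] m)) ⟩
  F (suc m) * F (suc n) + F (suc m) * F n      ≡⟨ *-distribˡ-+ (F (suc m)) (F (suc n)) (F n) ⟨
  F (suc m) * F (2 + n)                        <⟨ *-monoʳ-< (F (suc m)) {{>-nonZero (F-positive {suc m} (s≤s z≤n))}} (F[2+n]<3*F[n] 3≤n) ⟩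
  F (suc m) * (3 * F n)                        ≡⟨ reassociate (F (suc m)) (F n) ⟩
  3 * F (suc m) * F n                          ∎
  where
  open ≤-Reasoning
  reassociate : ∀ u v → u * (3 * v) ≡ 3 * u * v
  reassociate = ℕ-Solver.solve-∀

module _ {a b c a′ b′ : ℕ} (2≤a : 2 ≤ a) (2≤b : 2 ≤ b)
         (a≤a′ : a ≤ a′) (a′≤c : a′ ≤ c) (b≤b′ : b ≤ b′) (b′≤c : b′ ≤ c) where

  mval-antitone : mval a′ b′ c ℤ.≤ mval a b c
  mval-antitone = markoff⁺-antitone (F-positive (<⇒≤ 2≤a)) (F-positive (<⇒≤ 2≤b))
    (F-mono-≤ a≤a′) (F-mono-≤ a′≤c) (F-mono-≤ b≤b′) (F-mono-≤ b′≤c)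

  mval-≡⇔ : mval a b c ≡ mval a′ b′ c ⇔ (a ≡ a′ × b ≡ b′)
  mval-≡⇔ = mk⇔ same-indices λ { (refl , refl) → refl }
    where
    same-indices : mval a b c ≡ mval a′ b′ c → a ≡ a′ × b ≡ b′
    same-indices eq with markoff⁺-≡⇒≡ (F-positive (<⇒≤ 2≤a)) (F-positive (<⇒≤ 2≤b))
                          (F-mono-≤ a≤a′) (F-mono-≤ a′≤c) (F-mono-≤ b≤b′) (F-mono-≤ b′≤c) eq
    ... | Fa≡Fa′ , Fb≡Fb′ =
      F-injective 2≤a (≤-trans 2≤a a≤a′) Fa≡Fa′ , F-injective 2≤b (≤-trans 2≤b b≤b′) Fb≡Fb′

minimal⇒a+b<c : ∀ {a b c} → 1 ≤ a → a ≤ b → 5 ≤ c → 3 * F a * F b ≤ F c → a + b < c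
minimal⇒a+b<c {a} {b} {c} 1≤a a≤b 5≤c 3FaFb≤Fc with 3 ≤? b
... | yes 3≤b = ≰⇒> λ c≤a+b →
  <⇒≱ (F[m+n]<3*F[m]*F[n] 1≤a 3≤b) (≤-trans 3FaFb≤Fc (F-mono-≤ c≤a+b))
... | no 3≰b  = <-≤-trans (s≤s (+-mono-≤ (≤-trans a≤b b≤2) b≤2)) 5≤c
  where
  b≤2 : b ≤ 2
  b≤2 = ≤-pred (≰⇒> 3≰b)

a+b<c⇒b≤c∸a∸1 : ∀ {a b c} → a + b < c → b ≤ c ∸ a ∸ 1
a+b<c⇒b≤c∸a∸1 {a} {b} {c} a+b<c =
  m+n≤o⇒m≤o∸n b (m+n≤o⇒m≤o∸n (b + 1) (subst (_≤ c) (shuffle a b) a+b<c))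
  where
  shuffle : ∀ a b → suc (a + b) ≡ b + 1 + a
  shuffle = ℕ-Solver.solve-∀

lemma4p6 :
    ((a b c a′ b′ : ℕ) → 2 ≤ a → a ≤ b → b ≤ c → 5 ≤ c →
       a ≤ a′ → a′ ≤ c → b ≤ b′ → b′ ≤ c →
       (mval a′ b′ c ℤ.≤ mval a b c) ×
       (mval a b c ≡ mval a′ b′ c ⇔ (a ≡ a′ × b ≡ b′)))
    ×
    ((a b c : ℕ) (m : ℤ) → 2 ≤ a → a ≤ b → b ≤ c → 5 ≤ c →
       MinimalMarkoffTriple m (F a) (F b) (F c) → + 0 ℤ.< m →
       (mval a b c ℤ.≤ mval 2 2 c) × (mval a (c ∸ a ∸ 1) c ℤ.≤ mval a b c))
lemma4p6 =
  (λ a b c a′ b′ 2≤a a≤b _ _ a≤a′ a′≤c b≤b′ b′≤c →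
    let 2≤b : 2 ≤ b
        2≤b = ≤-trans 2≤a a≤b
    in mval-antitone 2≤a 2≤b a≤a′ a′≤c b≤b′ b′≤c , mval-≡⇔ 2≤a 2≤b a≤a′ a′≤c b≤b′ b′≤c) ,
  (λ a b c _ 2≤a a≤b b≤c 5≤c (_ , 3FaFb≤Fc) _ →
    let 2≤b : 2 ≤ b
        2≤b = ≤-trans 2≤a a≤b
        a≤c : a ≤ c
        a≤c = ≤-trans a≤b b≤c
        b≤c∸a∸1 : b ≤ c ∸ a ∸ 1
        b≤c∸a∸1 = a+b<c⇒b≤c∸a∸1 (minimal⇒a+b<c (<⇒≤ 2≤a) a≤b 5≤c 3FaFb≤Fc)
        c∸a∸1≤c : c ∸ a ∸ 1 ≤ c
        c∸a∸1≤c = ≤-trans (m∸n≤m (c ∸ a) 1) (m∸n≤m c a)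
    in mval-antitone ≤-refl ≤-refl 2≤a a≤c 2≤b b≤c ,
       mval-antitone 2≤a 2≤b ≤-refl a≤c b≤c∸a∸1 c∸a∸1≤c)
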